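{- Let $D>1$ be a square-free integer with $D\equiv1\pmod4$. Let $m_1,m_2$ be positive integers and $\mu_1,\mu_2$ integers with $\mu_j^2\equiv D\pmod{m_j}$ and, for each $j\in\{1,2\}$, either $m_j$ odd or $\frac{D-\mu_j^2}{m_j}$ odd. Let $n\ge1$ and $\nu$ an integer with $\nu^2\equiv D\pmod n$, and suppose $m_1\equiv m_2\equiv0\pmod n$ and $\mu_1\equiv\mu_2\equiv\nu\pmod n$. If there exists $\gamma\in\operatorname{SL}(2,\mathbb{Z})$ such that $$\begin{pmatrix}1&\mu_1\\0&m_1\end{pmatrix}\begin{pmatrix}\sqrt D&-\sqrt D\\1&1\end{pmatrix}\begin{pmatrix}\xi&0\\0&\overline\xi\end{pmatrix}=\gamma\begin{pmatrix}1&\mu_2\\0&m_2\end{pmatrix}\begin{pmatrix}\sqrt D&-\sqrt D\\1&1\end{pmatrix}$$ for some totally positive $\xi\in\mathbb{Q}(\sqrt D)$, then $\gamma\in\Gamma_0(n)$.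
   Context: "Either $m_j$ odd or $\frac{D-\mu_j^2}{m_j}$ odd" means $m_j$ odd, or $m_j$ even and $\frac{D-\mu_j^2}{m_j}$ odd. For $\xi=a+b\sqrt D$, $\overline\xi=a-b\sqrt D$ (with $\sqrt D>0$); $\xi$ is totally positive if $\xi>0$ and $\overline\xi>0$. $\Gamma_0(n)=\{\begin{pmatrix}a&b\\c&d\end{pmatrix}\in\operatorname{SL}(2,\mathbb{Z}):c\equiv0\pmod n\}$. -}

module Defs where

open import Data.Nat using (ℕ)
open import Data.Integer as ℤ using (ℤ; +_; ∣_∣)
open import Data.Integer.Divisibility using (_∣_)
open import Data.Rational as ℚ using (ℚ; 0ℚ)
open import Data.Product using (_×_; ∃)
open import Data.Sum using (_⊎_)
open import Relation.Nullary using (¬_)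
open import Relation.Binary.PropositionalEquality using (_≡_)

SquareFree : ℤ → Set
SquareFree D = (k : ℤ) → (k ℤ.* k) ∣ D → ∣ k ∣ ≡ 1

infix 4 _≣_[mod_]
_≣_[mod_] : ℤ → ℤ → ℤ → Set
a ≣ b [mod m ] = m ∣ (a ℤ.- b)

Odd : ℤ → Set
Odd k = ¬ ((+ 2) ∣ k)

OddCond : ℤ → ℤ → ℤ → Set
OddCond D m μ = Odd m ⊎ (((+ 2) ∣ m) × ∃ λ q → (D ℤ.- μ ℤ.* μ ≡ q ℤ.* m) × Odd q)

-- Elements a + b √D of Q(√D), for a fixed D (D > 1 square-free, so √D irrational)
record K : Set where
  constructor mkK
  field
    re : ℚ
    im : ℚ
open K public

ιℚ : ℤ → ℚ
ιℚ z = z ℚ./ 1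

ι : ℤ → K
ι z = mkK (ιℚ z) 0ℚ

√D : K
√D = mkK 0ℚ (ιℚ (+ 1))

_⊕_ : K → K → K
mkK a b ⊕ mkK c d = mkK (a ℚ.+ c) (b ℚ.+ d)

⊖_ : K → K
⊖ mkK a b = mkK (ℚ.- a) (ℚ.- b)

mulK : ℤ → K → K → K
mulK D (mkK a b) (mkK c d) = mkK (a ℚ.* c ℚ.+ b ℚ.* d ℚ.* ιℚ D) (a ℚ.* d ℚ.+ b ℚ.* c)

conj : K → K
conj (mkK a b) = mkK a (ℚ.- b)

-- a + b√D > 0 as a real number (√D > 0), written out in rational terms
Positive : ℤ → K → Set
Positive D (mkK a b) =
  (0ℚ ℚ.< a × 0ℚ ℚ.≤ b)
  ⊎ (0ℚ ℚ.< a × b ℚ.< 0ℚ × b ℚ.* b ℚ.* ιℚ D ℚ.< a ℚ.* a)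
  ⊎ (a ℚ.≤ 0ℚ × 0ℚ ℚ.< b × a ℚ.* a ℚ.< b ℚ.* b ℚ.* ιℚ D)

TotallyPositive : ℤ → K → Set
TotallyPositive D ξ = Positive D ξ × Positive D (conj ξ)

record M2 : Set where
  constructor mat
  field
    e11 e12 e21 e22 : K

mulM : ℤ → M2 → M2 → M2
mulM D (mat a b c d) (mat a' b' c' d') =
  mat (mulK D a a' ⊕ mulK D b c') (mulK D a b' ⊕ mulK D b d')
      (mulK D c a' ⊕ mulK D d c') (mulK D c b' ⊕ mulK D d d')

record M2ℤ : Set where
  constructor matℤ
  field
    a b c d : ℤ
open M2ℤ public

InSL2 : M2ℤ → Set
InSL2 (matℤ a b c d) = a ℤ.* d ℤ.- b ℤ.* c ≡ + 1

InΓ₀ : ℤ → M2ℤ → Set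
InΓ₀ n γ = InSL2 γ × (c γ ≣ + 0 [mod n ])

toM2 : M2ℤ → M2
toM2 (matℤ a b c d) = mat (ι a) (ι b) (ι c) (ι d)

Aμm : ℤ → ℤ → M2
Aμm μ m = mat (ι (+ 1)) (ι μ) (ι (+ 0)) (ι m)

W : M2
W = mat √D (⊖ √D) (ι (+ 1)) (ι (+ 1))

diag : K → K → M2
diag x y = mat x (ι (+ 0)) (ι (+ 0)) y

-- Comparing first columns, m₁ξ = c√D + (cμ₂ + dm₂) and (μ₁ + √D)ξ = a√D + (aμ₂ + bm₂).
-- Eliminating ξ and writing D − μ₁² = q m₁ gives the integer identities
-- c q = a(μ₂ − μ₁) + b m₂ and c(μ₁ + μ₂) = m₁a − d m₂, so n divides c q and c(μ₁ + μ₂).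
-- A common divisor t of n, q and μ₁ + μ₂ also divides m₁ and μ₁ − μ₂. If t is even this
-- contradicts the parity condition on m₁ and q; if t is odd then t ∣ μ₁, so t² divides
-- q m₁ + μ₁² = D and t = ±1. Hence n ∣ c.
module Submission where

open import Defs
open import Data.Integer as ℤ using (ℤ; +_; _<_; _≤_)
open import Data.Integer.Divisibility using (_∣_)
open import Data.Product using (_×_; ∃)

open import Level using (0ℓ)
open import Algebra.Bundles.Raw using (RawRing)
open import Data.Integer using (∣_∣)
import Data.Integer.Properties as ℤ
open import Data.Integer.Divisibility.Signed as Signed using (divides; ∣ᵤ⇒∣; ∣⇒∣ᵤ)
import Data.Integer.Solver as ℤSolver
open import Data.Nat as ℕ using (ℕ)
import Data.Nat.Divisibility as ℕ
import Data.Nat.Properties as ℕ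
open import Data.Nat.Coprimality using (Coprime; coprime-divisor)
open import Data.Nat.GCD using (gcd; gcd[m,n]∣m; gcd[m,n]∣n; gcd-greatest; c*gcd[m,n]≡gcd[cm,cn])
open import Data.Nat.Primality using (irreducible[2])
open import Data.Product using (_,_; proj₁; proj₂)
open import Data.Rational as ℚ using (ℚ; 0ℚ; 1ℚ)
open import Data.Rational.Properties using (+-*-rawRing; toℚᵘ-injective; toℚᵘ-fromℚᵘ; toℚᵘ-homo-+; toℚᵘ-homo-*; toℚᵘ-homo‿-; fromℚᵘ-injective)
import Data.Rational.Solver as ℚSolver
open import Data.Rational.Unnormalised as ℚᵘ using (mkℚᵘ; *≡*)
import Data.Rational.Unnormalised.Properties as ℚᵘ
open import Data.Sum using (_⊎_; inj₁; inj₂)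
open import Relation.Nullary using (¬_; yes; no; contradiction)
open import Relation.Binary.PropositionalEquality

private
  toℚᵘ-ιℚ : ∀ z → ℚ.toℚᵘ (ιℚ z) ℚᵘ.≃ mkℚᵘ z 0
  toℚᵘ-ιℚ z = toℚᵘ-fromℚᵘ (mkℚᵘ z 0)

ιℚ-homo-* : ∀ p q → ιℚ (p ℤ.* q) ≡ ιℚ p ℚ.* ιℚ q
ιℚ-homo-* p q = toℚᵘ-injective (ℚᵘ.≃-trans (toℚᵘ-ιℚ (p ℤ.* q))
  (ℚᵘ.≃-sym (ℚᵘ.≃-trans (toℚᵘ-homo-* (ιℚ p) (ιℚ q)) (ℚᵘ.*-cong (toℚᵘ-ιℚ p) (toℚᵘ-ιℚ q)))))

ιℚ-homo-+ : ∀ p q → ιℚ (p ℤ.+ q) ≡ ιℚ p ℚ.+ ιℚ q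
ιℚ-homo-+ p q = toℚᵘ-injective (ℚᵘ.≃-trans (toℚᵘ-ιℚ (p ℤ.+ q))
  (ℚᵘ.≃-sym (ℚᵘ.≃-trans (toℚᵘ-homo-+ (ιℚ p) (ιℚ q))
    (ℚᵘ.≃-trans (ℚᵘ.+-cong (toℚᵘ-ιℚ p) (toℚᵘ-ιℚ q)) (*≡* (cong (ℤ._* + 1) denominators-one))))))
  where
  denominators-one : p ℤ.* + 1 ℤ.+ q ℤ.* + 1 ≡ p ℤ.+ q
  denominators-one = cong₂ ℤ._+_ (ℤ.*-identityʳ p) (ℤ.*-identityʳ q)

ιℚ-homo‿- : ∀ p → ιℚ (ℤ.- p) ≡ ℚ.- ιℚ p
ιℚ-homo‿- p = toℚᵘ-injective (ℚᵘ.≃-trans (toℚᵘ-ιℚ (ℤ.- p))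
  (ℚᵘ.≃-sym (ℚᵘ.≃-trans (toℚᵘ-homo‿- (ιℚ p)) (ℚᵘ.-‿cong (toℚᵘ-ιℚ p)))))

ιℚ-homo-− : ∀ p q → ιℚ (p ℤ.- q) ≡ ιℚ p ℚ.- ιℚ q
ιℚ-homo-− p q = trans (ιℚ-homo-+ p (ℤ.- q)) (cong (ιℚ p ℚ.+_) (ιℚ-homo‿- q))

ιℚ-injective : ∀ {p q} → ιℚ p ≡ ιℚ q → p ≡ q
ιℚ-injective {p} {q} eq with fromℚᵘ-injective {mkℚᵘ p 0} {mkℚᵘ q 0} eq
... | *≡* p*1≡q*1 = trans (sym (ℤ.*-identityʳ p)) (trans p*1≡q*1 (ℤ.*-identityʳ q))

-- The arithmetic of Defs (Q(√D) and 2×2 matrices over it), clause for clause, over any raw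
-- ring. At ℚ it agrees definitionally with mulM; at solver polynomials it lets the ring
-- solver compute the entries of the two sides of the matrix identity.
module Arithmetic (R : RawRing 0ℓ 0ℓ) (δ : RawRing.Carrier R) where
  open RawRing R

  record Q√ : Set where
    constructor ⟨_,_⟩
    field re im : Carrier

  infixl 6 _⊞_
  infixl 7 _⊠_

  _⊞_ : Q√ → Q√ → Q√
  ⟨ a , b ⟩ ⊞ ⟨ c , d ⟩ = ⟨ a + c , b + d ⟩

  _⊠_ : Q√ → Q√ → Q√
  ⟨ a , b ⟩ ⊠ ⟨ c , d ⟩ = ⟨ a * c + b * d * δ , a * d + b * c ⟩

  const : Carrier → Q√
  const a = ⟨ a , 0# ⟩

  record Mat : Set where
    constructor mat
    field e11 e12 e21 e22 : Q√

  infixl 7 _⊛_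
  _⊛_ : Mat → Mat → Mat
  mat a b c d ⊛ mat a' b' c' d' =
    mat (a ⊠ a' ⊞ b ⊠ c') (a ⊠ b' ⊞ b ⊠ d') (c ⊠ a' ⊞ d ⊠ c') (c ⊠ b' ⊞ d ⊠ d')

  upper : Carrier → Carrier → Mat
  upper μ m = mat (const 1#) (const μ) (const 0#) (const m)

  W′ : Mat
  W′ = mat ⟨ 0# , 1# ⟩ ⟨ - 0# , - 1# ⟩ (const 1#) (const 1#)

  lhs : (μ m x y : Carrier) → Mat
  lhs μ m x y = upper μ m ⊛ W′ ⊛ mat ⟨ x , y ⟩ (const 0#) (const 0#) ⟨ x , - y ⟩

  rhs : (μ m a b c d : Carrier) → Mat
  rhs μ m a b c d = mat (const a) (const b) (const c) (const d) ⊛ upper μ m ⊛ W′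

module ℚArith = Arithmetic +-*-rawRing

open Arithmetic using (⟨_,_⟩)
open Arithmetic.Q√
open Arithmetic.Mat

polyRing : (n : ℕ) → RawRing 0ℓ 0ℓ
polyRing n = record
  { Carrier = Polynomial n ; _≈_ = _≡_ ; _+_ = _:+_ ; _*_ = _:*_ ; -_ = :-_
  ; 0# = con 0ℚ ; 1# = con 1ℚ }
  where open ℚSolver.+-*-Solver

module PolyArith {n} = Arithmetic (polyRing n)

module _ (δ : ℚ) where
  open ℚArith δ using (lhs; rhs)
  open import Data.Rational using (_+_; _*_)
  open ℚSolver.+-*-Solver

  lhs-first-column : ∀ μ m x y →
    e11 (lhs μ m x y) ≡ ⟨ μ * x + y * δ , μ * y + x ⟩ × e21 (lhs μ m x y) ≡ ⟨ m * x , m * y ⟩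
  lhs-first-column μ m x y =
    cong₂ ⟨_,_⟩ (solve 5 (λ δ μ m x y → re (e11 (PolyArith.lhs δ μ m x y)) := μ :* x :+ y :* δ) refl δ μ m x y)
                (solve 5 (λ δ μ m x y → im (e11 (PolyArith.lhs δ μ m x y)) := μ :* y :+ x) refl δ μ m x y) ,
    cong₂ ⟨_,_⟩ (solve 5 (λ δ μ m x y → re (e21 (PolyArith.lhs δ μ m x y)) := m :* x) refl δ μ m x y)
                (solve 5 (λ δ μ m x y → im (e21 (PolyArith.lhs δ μ m x y)) := m :* y) refl δ μ m x y)

  rhs-first-column : ∀ μ m a b c d →
    e11 (rhs μ m a b c d) ≡ ⟨ a * μ + b * m , a ⟩ × e21 (rhs μ m a b c d) ≡ ⟨ c * μ + d * m , c ⟩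
  rhs-first-column μ m a b c d =
    cong₂ ⟨_,_⟩ (solve 7 (λ δ μ m a b c d → re (e11 (PolyArith.rhs δ μ m a b c d)) := a :* μ :+ b :* m) refl δ μ m a b c d)
                (solve 7 (λ δ μ m a b c d → im (e11 (PolyArith.rhs δ μ m a b c d)) := a) refl δ μ m a b c d) ,
    cong₂ ⟨_,_⟩ (solve 7 (λ δ μ m a b c d → re (e21 (PolyArith.rhs δ μ m a b c d)) := c :* μ :+ d :* m) refl δ μ m a b c d)
                (solve 7 (λ δ μ m a b c d → im (e21 (PolyArith.rhs δ μ m a b c d)) := c) refl δ μ m a b c d)

module _ where
  open import Data.Rational using (_+_; _-_; _*_)
  open ℚSolver.+-*-Solver
  open ≡-Reasoning

  eliminate-ξ : ∀ {δ u₁ n₁ u₂ n₂ a b c d x y : ℚ} →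
    u₁ * x + y * δ ≡ a * u₂ + b * n₂ → u₁ * y + x ≡ a →
    n₁ * x ≡ c * u₂ + d * n₂ → n₁ * y ≡ c →
    c * (δ - u₁ * u₁) ≡ n₁ * (a * (u₂ - u₁) + b * n₂) × c * (u₁ + u₂) ≡ n₁ * a - d * n₂
  eliminate-ξ {δ} {u₁} {n₁} {u₂} {n₂} {b = b} {d = d} {x} {y} e₁₁ refl e₂₁ refl =
    sym (begin
      n₁ * ((u₁ * y + x) * (u₂ - u₁) + b * n₂)
        ≡⟨ solve 7 (λ n₁ u₁ u₂ n₂ b x y →
             n₁ :* ((u₁ :* y :+ x) :* (u₂ :- u₁) :+ b :* n₂)
               := n₁ :* ((u₁ :* y :+ x) :* u₂ :+ b :* n₂) :- n₁ :* u₁ :* (u₁ :* y :+ x))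
             refl n₁ u₁ u₂ n₂ b x y ⟩
      n₁ * ((u₁ * y + x) * u₂ + b * n₂) - n₁ * u₁ * (u₁ * y + x)
        ≡⟨ cong (λ t → n₁ * t - n₁ * u₁ * (u₁ * y + x)) (sym e₁₁) ⟩
      n₁ * (u₁ * x + y * δ) - n₁ * u₁ * (u₁ * y + x)
        ≡⟨ solve 5 (λ δ n₁ u₁ x y →
             n₁ :* (u₁ :* x :+ y :* δ) :- n₁ :* u₁ :* (u₁ :* y :+ x) := n₁ :* y :* (δ :- u₁ :* u₁))
             refl δ n₁ u₁ x y ⟩
      n₁ * y * (δ - u₁ * u₁) ∎) ,
    sym (begin
      n₁ * (u₁ * y + x) - d * n₂
        ≡⟨ solve 6 (λ n₁ u₁ n₂ d x y → n₁ :* (u₁ :* y :+ x) :- d :* n₂ := n₁ :* y :* u₁ :+ n₁ :* x :- d :* n₂)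
             refl n₁ u₁ n₂ d x y ⟩
      n₁ * y * u₁ + n₁ * x - d * n₂
        ≡⟨ cong (λ t → n₁ * y * u₁ + t - d * n₂) e₂₁ ⟩
      n₁ * y * u₁ + (n₁ * y * u₂ + d * n₂) - d * n₂
        ≡⟨ solve 6 (λ n₁ u₁ u₂ n₂ d y → n₁ :* y :* u₁ :+ (n₁ :* y :* u₂ :+ d :* n₂) :- d :* n₂ := n₁ :* y :* (u₁ :+ u₂))
             refl n₁ u₁ u₂ n₂ d y ⟩
      n₁ * y * (u₁ + u₂) ∎)

toMat : (δ : ℚ) → M2 → ℚArith.Mat δ
toMat δ (mat (mkK a b) (mkK c d) (mkK e f) (mkK g h)) = Arithmetic.mat ⟨ a , b ⟩ ⟨ c , d ⟩ ⟨ e , f ⟩ ⟨ g , h ⟩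

module _ (D : ℤ) (μ₁ m₁ μ₂ m₂ a b c d : ℤ) (x y : ℚ) where
  open import Data.Rational using (_+_; _-_; _*_)
  private
    δ = ιℚ D ; u₁ = ιℚ μ₁ ; n₁ = ιℚ m₁ ; u₂ = ιℚ μ₂ ; n₂ = ιℚ m₂
    a′ = ιℚ a ; b′ = ιℚ b ; c′ = ιℚ c ; d′ = ιℚ d

  MatrixEquation : Set
  MatrixEquation = mulM D (mulM D (Aμm μ₁ m₁) W) (diag (mkK x y) (conj (mkK x y)))
                     ≡ mulM D (mulM D (toM2 (matℤ a b c d)) (Aμm μ₂ m₂)) W

  first-column-equations : MatrixEquation →
    ⟨ u₁ * x + y * δ , u₁ * y + x ⟩ ≡ ⟨ a′ * u₂ + b′ * n₂ , a′ ⟩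
      × ⟨ n₁ * x , n₁ * y ⟩ ≡ ⟨ c′ * u₂ + d′ * n₂ , c′ ⟩
  first-column-equations eq =
    trans (sym (proj₁ lhs)) (trans (cong e11 same) (proj₁ rhs)) ,
    trans (sym (proj₂ lhs)) (trans (cong e21 same) (proj₂ rhs))
    where
    same = cong (toMat δ) eq
    lhs = lhs-first-column δ u₁ n₁ x y
    rhs = rhs-first-column δ u₂ n₂ a′ b′ c′ d′

  integer-identities : MatrixEquation →
    c ℤ.* (D ℤ.- μ₁ ℤ.* μ₁) ≡ m₁ ℤ.* (a ℤ.* (μ₂ ℤ.- μ₁) ℤ.+ b ℤ.* m₂)
      × c ℤ.* (μ₁ ℤ.+ μ₂) ≡ m₁ ℤ.* a ℤ.- d ℤ.* m₂
  integer-identities eq = ιℚ-injective norm-identity , ιℚ-injective trace-identity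
    where
    open ≡-Reasoning
    column = first-column-equations eq
    rational-identities = eliminate-ξ {δ} {u₁} {n₁} {u₂} {n₂} {a′} {b′} {c′} {d′} {x} {y}
      (cong re (proj₁ column)) (cong im (proj₁ column)) (cong re (proj₂ column)) (cong im (proj₂ column))
    norm-identity : ιℚ (c ℤ.* (D ℤ.- μ₁ ℤ.* μ₁)) ≡ ιℚ (m₁ ℤ.* (a ℤ.* (μ₂ ℤ.- μ₁) ℤ.+ b ℤ.* m₂))
    norm-identity = begin
      ιℚ (c ℤ.* (D ℤ.- μ₁ ℤ.* μ₁))
        ≡⟨ ιℚ-homo-* c _ ⟩
      c′ * ιℚ (D ℤ.- μ₁ ℤ.* μ₁)
        ≡⟨ cong (c′ *_) (trans (ιℚ-homo-− D _) (cong (δ -_) (ιℚ-homo-* μ₁ μ₁))) ⟩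
      c′ * (δ - u₁ * u₁)
        ≡⟨ proj₁ rational-identities ⟩
      n₁ * (a′ * (u₂ - u₁) + b′ * n₂)
        ≡⟨ cong (n₁ *_) (cong₂ _+_ (trans (ιℚ-homo-* a _) (cong (a′ *_) (ιℚ-homo-− μ₂ μ₁))) (ιℚ-homo-* b m₂)) ⟨
      n₁ * (ιℚ (a ℤ.* (μ₂ ℤ.- μ₁)) + ιℚ (b ℤ.* m₂))
        ≡⟨ trans (ιℚ-homo-* m₁ _) (cong (n₁ *_) (ιℚ-homo-+ (a ℤ.* (μ₂ ℤ.- μ₁)) (b ℤ.* m₂))) ⟨
      ιℚ (m₁ ℤ.* (a ℤ.* (μ₂ ℤ.- μ₁) ℤ.+ b ℤ.* m₂)) ∎
    trace-identity : ιℚ (c ℤ.* (μ₁ ℤ.+ μ₂)) ≡ ιℚ (m₁ ℤ.* a ℤ.- d ℤ.* m₂)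
    trace-identity = begin
      ιℚ (c ℤ.* (μ₁ ℤ.+ μ₂))             ≡⟨ trans (ιℚ-homo-* c _) (cong (c′ *_) (ιℚ-homo-+ μ₁ μ₂)) ⟩
      c′ * (u₁ + u₂)                     ≡⟨ proj₂ rational-identities ⟩
      n₁ * a′ - d′ * n₂                  ≡⟨ trans (ιℚ-homo-− (m₁ ℤ.* a) (d ℤ.* m₂)) (cong₂ _-_ (ιℚ-homo-* m₁ a) (ιℚ-homo-* d m₂)) ⟨
      ιℚ (m₁ ℤ.* a ℤ.- d ℤ.* m₂)         ∎

odd⇒coprime[2] : ∀ {n} → ¬ 2 ℕ.∣ n → Coprime n 2
odd⇒coprime[2] 2∤n {d} (d∣n , d∣2) with irreducible[2] d∣2
... | inj₁ d≡1 = d≡1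
... | inj₂ refl = contradiction d∣n 2∤n

odd-∣m+n∧∣m-n⇒∣m : ∀ {t m n} → Odd t → t Signed.∣ m ℤ.+ n → t Signed.∣ m ℤ.- n → t Signed.∣ m
odd-∣m+n∧∣m-n⇒∣m {t} {m} {n} odd-t t∣m+n t∣m-n =
  ∣ᵤ⇒∣ (coprime-divisor (odd⇒coprime[2] odd-t) (subst (∣ t ∣ ℕ.∣_) (ℤ.abs-* (+ 2) m) (∣⇒∣ᵤ t∣2m)))
  where
  open ℤSolver.+-*-Solver
  t∣2m : t Signed.∣ + 2 ℤ.* m
  t∣2m = subst (t Signed.∣_)
    (solve 2 (λ m n → (m :+ n) :+ (m :- n) := con (+ 2) :* m) refl m n)
    (Signed.∣m∣n⇒∣m+n t∣m+n t∣m-n)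

OddCond⇒odd : ∀ {D m μ q} .{{_ : ℤ.NonZero m}} →
  OddCond D m μ → D ℤ.- μ ℤ.* μ ≡ q ℤ.* m → Odd m ⊎ Odd q
OddCond⇒odd (inj₁ odd-m) _ = inj₁ odd-m
OddCond⇒odd {m = m} {q = q} (inj₂ (_ , q′ , e′ , odd-q′)) e =
  inj₂ (subst Odd (ℤ.*-cancelʳ-≡ q′ q m (trans (sym e′) e)) odd-q′)

SquareFree⇒common-divisor-unit : ∀ {D m μ q t} → SquareFree D → D ℤ.- μ ℤ.* μ ≡ q ℤ.* m →
  t Signed.∣ m → t Signed.∣ q → t Signed.∣ μ → ∣ t ∣ ≡ 1
SquareFree⇒common-divisor-unit {D} {m} {μ} {q} {t} sqf e t∣m t∣q t∣μ = sqf t (∣⇒∣ᵤ t²∣D)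
  where
  open ℤSolver.+-*-Solver
  t²∣ : ∀ {i j} → t Signed.∣ i → t Signed.∣ j → t ℤ.* t Signed.∣ i ℤ.* j
  t²∣ {i} t∣i t∣j = Signed.∣-trans (Signed.*-monoʳ-∣ t t∣j) (Signed.*-monoˡ-∣ _ t∣i)
  D≡ : q ℤ.* m ℤ.+ μ ℤ.* μ ≡ D
  D≡ = trans (cong (ℤ._+ μ ℤ.* μ) (sym e)) (solve 2 (λ D μ → (D :- μ :* μ) :+ μ :* μ := D) refl D μ)
  t²∣D : t ℤ.* t Signed.∣ D
  t²∣D = subst (_ Signed.∣_) D≡ (Signed.∣m∣n⇒∣m+n (t²∣ t∣q t∣m) (t²∣ t∣μ t∣μ))

OddCond⇒common-divisor-unit : ∀ {D m μ μ′ q t} .{{_ : ℤ.NonZero m}} →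
  SquareFree D → OddCond D m μ → D ℤ.- μ ℤ.* μ ≡ q ℤ.* m →
  t Signed.∣ m → t Signed.∣ q → t Signed.∣ μ ℤ.+ μ′ → t Signed.∣ μ ℤ.- μ′ → ∣ t ∣ ≡ 1
OddCond⇒common-divisor-unit {D} {m} {μ} {μ′} {q} {t} sqf odd e t∣m t∣q t∣μ+μ′ t∣μ-μ′ with 2 ℕ.∣? ∣ t ∣
... | no odd-t = SquareFree⇒common-divisor-unit {D} {m} {μ} {q} {t} sqf e t∣m t∣q
  (odd-∣m+n∧∣m-n⇒∣m {t} {μ} {μ′} odd-t t∣μ+μ′ t∣μ-μ′)
... | yes 2∣t with OddCond⇒odd {D} {m} {μ} {q} odd e
...   | inj₁ odd-m = contradiction (ℕ.∣-trans 2∣t (∣⇒∣ᵤ t∣m)) odd-m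
...   | inj₂ odd-q = contradiction (ℕ.∣-trans 2∣t (∣⇒∣ᵤ t∣q)) odd-q

coprime-gcd⇒∣ : ∀ {n a b c} → Coprime n (gcd a b) → n ℕ.∣ c ℕ.* a → n ℕ.∣ c ℕ.* b → n ℕ.∣ c
coprime-gcd⇒∣ {n} {a} {b} {c} n⊥gcd n∣ca n∣cb = coprime-divisor n⊥gcd
  (subst (n ℕ.∣_) (trans (sym (c*gcd[m,n]≡gcd[cm,cn] c a b)) (ℕ.*-comm c (gcd a b))) (gcd-greatest n∣ca n∣cb))

∣-cancel-cofactors : ∀ {D m μ μ′ q n c} .{{_ : ℤ.NonZero m}} →
  SquareFree D → OddCond D m μ → D ℤ.- μ ℤ.* μ ≡ q ℤ.* m →
  n Signed.∣ m → n Signed.∣ μ ℤ.- μ′ → n Signed.∣ c ℤ.* q → n Signed.∣ c ℤ.* (μ ℤ.+ μ′) → n ∣ c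
∣-cancel-cofactors {D} {m} {μ} {μ′} {q} {n} {c} sqf odd e n∣m n∣μ-μ′ n∣cq n∣cs =
  coprime-gcd⇒∣ n⊥gcd (abs-∣ c q n∣cq) (abs-∣ c (μ ℤ.+ μ′) n∣cs)
  where
  abs-∣ : ∀ i j → n Signed.∣ i ℤ.* j → ∣ n ∣ ℕ.∣ ∣ i ∣ ℕ.* ∣ j ∣
  abs-∣ i j n∣ij = subst (∣ n ∣ ℕ.∣_) (ℤ.abs-* i j) (∣⇒∣ᵤ n∣ij)
  n⊥gcd : Coprime ∣ n ∣ (gcd ∣ q ∣ ∣ μ ℤ.+ μ′ ∣)
  n⊥gcd {t} (t∣n , t∣gcd) = OddCond⇒common-divisor-unit {D} {m} {μ} {μ′} {q} {+ t} sqf odd e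
    (Signed.∣-trans (∣ᵤ⇒∣ t∣n) n∣m)
    (∣ᵤ⇒∣ (ℕ.∣-trans t∣gcd (gcd[m,n]∣m ∣ q ∣ ∣ μ ℤ.+ μ′ ∣)))
    (∣ᵤ⇒∣ (ℕ.∣-trans t∣gcd (gcd[m,n]∣n ∣ q ∣ ∣ μ ℤ.+ μ′ ∣)))
    (Signed.∣-trans (∣ᵤ⇒∣ t∣n) n∣μ-μ′)

≣0⇒∣ : ∀ n a → a ≣ + 0 [mod n ] → n Signed.∣ a
≣0⇒∣ n a a≣0 = subst (n Signed.∣_) (ℤ.+-identityʳ a) (∣ᵤ⇒∣ {n} {a ℤ.- + 0} a≣0)

≣-common⇒∣-diff : ∀ n a b c → a ≣ c [mod n ] → b ≣ c [mod n ] → n Signed.∣ a ℤ.- b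
≣-common⇒∣-diff n a b c a≣c b≣c = subst (n Signed.∣_)
  (solve 3 (λ a b c → (a :- c) :- (b :- c) := a :- b) refl a b c)
  (Signed.∣m∣n⇒∣m-n (∣ᵤ⇒∣ {n} {a ℤ.- c} a≣c) (∣ᵤ⇒∣ {n} {b ℤ.- c} b≣c))
  where open ℤSolver.+-*-Solver

≣⇒quotient : ∀ m a b → a ≣ b [mod m ] → ∃ λ q → b ℤ.- a ≡ q ℤ.* m
≣⇒quotient m a b a≣b with ∣ᵤ⇒∣ {m} {a ℤ.- b} a≣b
... | divides k a-b≡km = ℤ.- k , (begin
  b ℤ.- a          ≡⟨ solve 2 (λ a b → b :- a := :- (a :- b)) refl a b ⟩
  ℤ.- (a ℤ.- b)    ≡⟨ cong ℤ.-_ a-b≡km ⟩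
  ℤ.- (k ℤ.* m)    ≡⟨ ℤ.neg-distribˡ-* k m ⟩
  ℤ.- k ℤ.* m      ∎)
  where
  open ℤSolver.+-*-Solver
  open ≡-Reasoning

cancel-quotient : ∀ c q m X {s} .{{_ : ℤ.NonZero m}} →
  s ≡ q ℤ.* m → c ℤ.* s ≡ m ℤ.* X → c ℤ.* q ≡ X
cancel-quotient c q m X {s} s≡qm cs≡mX = ℤ.*-cancelʳ-≡ (c ℤ.* q) X m (begin
  c ℤ.* q ℤ.* m    ≡⟨ ℤ.*-assoc c q m ⟩
  c ℤ.* (q ℤ.* m)  ≡⟨ cong (c ℤ.*_) s≡qm ⟨
  c ℤ.* s          ≡⟨ cs≡mX ⟩
  m ℤ.* X          ≡⟨ ℤ.*-comm m X ⟩
  X ℤ.* m          ∎)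
  where open ≡-Reasoning

lemma3p4 : (D : ℤ) → + 1 < D → SquareFree D → D ≣ + 1 [mod + 4 ] →
    (m₁ m₂ μ₁ μ₂ : ℤ) → + 0 < m₁ → + 0 < m₂ →
    μ₁ ℤ.* μ₁ ≣ D [mod m₁ ] → μ₂ ℤ.* μ₂ ≣ D [mod m₂ ] →
    OddCond D m₁ μ₁ → OddCond D m₂ μ₂ →
    (n ν : ℤ) → + 1 ≤ n → ν ℤ.* ν ≣ D [mod n ] →
    m₁ ≣ + 0 [mod n ] → m₂ ≣ + 0 [mod n ] →
    μ₁ ≣ ν [mod n ] → μ₂ ≣ ν [mod n ] →
    (γ : M2ℤ) → InSL2 γ →
    (∃ λ ξ → TotallyPositive D ξ ×
      (mulM D (mulM D (Aμm μ₁ m₁) W) (diag ξ (conj ξ))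
        ≡ mulM D (mulM D (toM2 γ) (Aμm μ₂ m₂)) W)) →
    InΓ₀ n γ
lemma3p4 D _ sqf _ m₁ m₂ μ₁ μ₂ 0<m₁ _ μ₁²≣D _ odd₁ _ n ν _ _ m₁≣0 m₂≣0 μ₁≣ν μ₂≣ν
         (matℤ a b c d) det (mkK x y , _ , eq) =
  det , subst (n ∣_) (sym (ℤ.+-identityʳ c)) n∣c
  where
  instance _ = ℤ.>-nonZero 0<m₁
  quotient = ≣⇒quotient m₁ (μ₁ ℤ.* μ₁) D μ₁²≣D
  q = proj₁ quotient
  identities = integer-identities D μ₁ m₁ μ₂ m₂ a b c d x y eq
  n∣m₁ = ≣0⇒∣ n m₁ m₁≣0
  n∣m₂ = ≣0⇒∣ n m₂ m₂≣0
  n∣cq : n Signed.∣ c ℤ.* q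
  n∣cq = subst (n Signed.∣_) (sym (cancel-quotient c q m₁ _ (proj₂ quotient) (proj₁ identities)))
    (Signed.∣m∣n⇒∣m+n (Signed.∣n⇒∣m*n a (≣-common⇒∣-diff n μ₂ μ₁ ν μ₂≣ν μ₁≣ν)) (Signed.∣n⇒∣m*n b n∣m₂))
  n∣c[μ₁+μ₂] : n Signed.∣ c ℤ.* (μ₁ ℤ.+ μ₂)
  n∣c[μ₁+μ₂] = subst (n Signed.∣_) (sym (proj₂ identities))
    (Signed.∣m∣n⇒∣m-n (Signed.∣m⇒∣m*n a n∣m₁) (Signed.∣n⇒∣m*n d n∣m₂))
  n∣c : n ∣ c
  n∣c = ∣-cancel-cofactors {D} {m₁} {μ₁} {μ₂} {q} {n} {c} sqf odd₁ (proj₂ quotient) n∣m₁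
    (≣-common⇒∣-diff n μ₁ μ₂ ν μ₁≣ν μ₂≣ν) n∣cq n∣c[μ₁+μ₂]
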